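{- Let $\Gamma=(V,E)$ be a finite graph with a connection $\nabla$ and a compatible axial function $\alpha:E\to\mathbb{R}^n\setminus\{0\}$ which is $3$-independent. Let $F$ be a two-face of $\Gamma$, let $p$ be a vertex of $F$, let $e_1,e_2$ be the two edges of $F$ at $p$, and let $W=\mathrm{span}\{\alpha(e_1),\alpha(e_2)\}$. Then $\alpha(e)\in W$ for every edge $e$ of $F$.
   Context: Oriented edges: each edge counted with both orientations; $e=(x,y)$ has $e^{ -1}=(y,x)$; $\mathrm{star}(x)$ is the set of oriented edges starting at $x$. A connection: maps $\nabla_{(x,y)}:\mathrm{star}(x)\to\mathrm{star}(y)$ with $\nabla_{(x,y)}(x,y)=(y,x)$, $\nabla_{(y,x)}=\nabla_{(x,y)}^{ -1}$. Compatible axial function: $\alpha(e^{ -1})=-\alpha(e)$ and for every triple of oriented edges $((x,y),(y,z),(z,w))$ with $\nabla_{(y,z)}(y,x)=(z,w)$ the three images under $\alpha$ are coplanar. $3$-independent: at each vertex any three vectors $\alpha(e)$, $e\in\mathrm{star}(p)$, are linearly independent. A subgraph $(V_0,E_0)$ is totally geodesic if for every edge $(x,y)\in E_0$, $\nabla_{(x,y)}(\mathrm{star}(x)\cap E_0)\subseteq E_0$. A two-face is a connected totally geodesic subgraph in which every vertex has exactly two edges.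
   Formalization: 3-independence also demands that at each vertex p any two vectors α(e), e∈star(p), coming from distinct edges be linearly independent, not only any three. The paper assumes this as well. -}

module Defs where

open import Level using (Level; _⊔_) renaming (suc to lsuc)
open import Algebra.Bundles using (CommutativeRing)
open import Data.Nat using (ℕ)
open import Data.Fin using (Fin)
open import Data.Bool using (Bool; true)
open import Data.Product using (Σ; ∃; ∃-syntax; _×_; _,_)
open import Data.Sum using (_⊎_)
open import Relation.Binary.PropositionalEquality using (_≡_)
open import Relation.Nullary using (¬_)

record Field (c ℓ : Level) : Set (lsuc (c ⊔ ℓ)) where
  field
    commutativeRing : CommutativeRing c ℓ
  open CommutativeRing commutativeRing public
  field
    0≉1     : ¬ (0# ≈ 1#)
    inverse : ∀ x → ¬ (x ≈ 0#) → ∃[ y ] (x * y ≈ 1#)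

-- An oriented edge is a pair (x , y)
-- with x adjacent to y; both orientations of every edge occur.

record Graph (m : ℕ) : Set where
  field
    adj     : Fin m → Fin m → Bool
    symm    : ∀ x y → adj x y ≡ true → adj y x ≡ true
    irrefl  : ∀ x → ¬ (adj x x ≡ true)

module _ {m : ℕ} (Γ : Graph m) where
  open Graph Γ

  Edge : Fin m → Fin m → Set
  Edge x y = adj x y ≡ true

  -- a connection: for every oriented edge (x,y), a map
  -- ∇_(x,y) : star(x) → star(y), written on the endpoint of the edge,
  -- with ∇_(x,y)(x,y) = (y,x) and ∇_(y,x) = ∇_(x,y)⁻¹.
  record Connection : Set where
    field
      ∇        : (x y : Fin m) → Edge x y → (z : Fin m) → Edge x z → Fin m
      ∇-edge   : ∀ x y (e : Edge x y) z (f : Edge x z) → Edge y (∇ x y e z f)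
      ∇-base   : ∀ x y (e : Edge x y) → ∇ x y e y e ≡ x
      ∇-inv    : ∀ x y (e : Edge x y) (e' : Edge y x) z (f : Edge x z) →
                 ∇ y x e' (∇ x y e z f) (∇-edge x y e z f) ≡ z

  record Subgraph : Set where
    field
      V₀      : Fin m → Bool
      E₀      : Fin m → Fin m → Bool
      E₀⊆E    : ∀ x y → E₀ x y ≡ true → Edge x y
      E₀-symm : ∀ x y → E₀ x y ≡ true → E₀ y x ≡ true
      E₀-V₀   : ∀ x y → E₀ x y ≡ true → V₀ x ≡ true

  module _ (∇c : Connection) (F : Subgraph) where
    open Connection ∇c
    open Subgraph F

    TotallyGeodesic : Set
    TotallyGeodesic = ∀ x y (e : E₀ x y ≡ true) z (f : E₀ x z ≡ true) →
      E₀ y (∇ x y (E₀⊆E x y e) z (E₀⊆E x z f)) ≡ true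

  module _ (F : Subgraph) where
    open Subgraph F

    data Walk : Fin m → Fin m → Set where
      stop : ∀ {x} → Walk x x
      step : ∀ {x y z} → E₀ x y ≡ true → Walk y z → Walk x z

    Connected : Set
    Connected = ∀ x y → V₀ x ≡ true → V₀ y ≡ true → Walk x y

    TwoValent : Set
    TwoValent = ∀ x → V₀ x ≡ true →
      Σ (Fin m) λ y₁ → Σ (Fin m) λ y₂ →
        ¬ (y₁ ≡ y₂) × E₀ x y₁ ≡ true × E₀ x y₂ ≡ true ×
        (∀ y → E₀ x y ≡ true → (y ≡ y₁) ⊎ (y ≡ y₂))

  TwoFace : Connection → Subgraph → Set
  TwoFace ∇c F = Connected F × TotallyGeodesic ∇c F × TwoValent F

module LinAlg {c ℓ : Level} (K : Field c ℓ) (n : ℕ) where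
  open Field K

  Vect : Set c
  Vect = Fin n → Carrier

  _≈ᵛ_ : Vect → Vect → Set ℓ
  u ≈ᵛ v = ∀ i → u i ≈ v i

  0ᵛ : Vect
  0ᵛ i = 0#

  -ᵛ_ : Vect → Vect
  (-ᵛ u) i = - (u i)

  lin2 : Carrier → Vect → Carrier → Vect → Vect
  lin2 a u b v i = a * u i + b * v i

  lin3 : Carrier → Vect → Carrier → Vect → Carrier → Vect → Vect
  lin3 a u b v d w i = a * u i + b * v i + d * w i

  Coplanar : Vect → Vect → Vect → Set (c ⊔ ℓ)
  Coplanar u v w = ∃[ a ] ∃[ b ] ∃[ d ]
    (lin3 a u b v d w ≈ᵛ 0ᵛ × ¬ (a ≈ 0# × b ≈ 0# × d ≈ 0#))

  Independent2 : Vect → Vect → Set (c ⊔ ℓ)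
  Independent2 u v = ∀ a b → lin2 a u b v ≈ᵛ 0ᵛ → a ≈ 0# × b ≈ 0#

  Independent3 : Vect → Vect → Vect → Set (c ⊔ ℓ)
  Independent3 u v w = ∀ a b d → lin3 a u b v d w ≈ᵛ 0ᵛ →
    a ≈ 0# × b ≈ 0# × d ≈ 0#

  InSpan2 : Vect → Vect → Vect → Set (c ⊔ ℓ)
  InSpan2 u v w = ∃[ a ] ∃[ b ] (w ≈ᵛ lin2 a u b v)

  module _ {m : ℕ} (Γ : Graph m) where
    open Graph Γ

    AxialFunction : Set c
    AxialFunction = (x y : Fin m) → Edge Γ x y → Vect

    module _ (∇c : Connection Γ) (α : AxialFunction) where
      open Connection ∇c

      NonZero : Set ℓ
      NonZero = ∀ x y (e : Edge Γ x y) → ¬ (α x y e ≈ᵛ 0ᵛ)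

      Compatible : Set (c ⊔ ℓ)
      Compatible =
        (∀ x y (e : Edge Γ x y) (e' : Edge Γ y x) → α y x e' ≈ᵛ (-ᵛ α x y e)) ×
        (∀ x y z w (exy : Edge Γ x y) (eyz : Edge Γ y z) (ezw : Edge Γ z w)
           (eyx : Edge Γ y x) →
           ∇ y z eyz x eyx ≡ w →
           Coplanar (α x y exy) (α y z eyz) (α z w ezw))

      ThreeIndependent : Set (c ⊔ ℓ)
      ThreeIndependent =
        (∀ p y₁ y₂ (e₁ : Edge Γ p y₁) (e₂ : Edge Γ p y₂) →
           ¬ (y₁ ≡ y₂) → Independent2 (α p y₁ e₁) (α p y₂ e₂)) ×
        (∀ p y₁ y₂ y₃ (e₁ : Edge Γ p y₁) (e₂ : Edge Γ p y₂) (e₃ : Edge Γ p y₃) →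
           ¬ (y₁ ≡ y₂) → ¬ (y₁ ≡ y₃) → ¬ (y₂ ≡ y₃) →
           Independent3 (α p y₁ e₁) (α p y₂ e₂) (α p y₃ e₃))

-- At a vertex v of F with F-neighbours v' and u, total geodesy makes w = ∇_(v,u)(v,v') the
-- other F-neighbour of u (w ≠ v since ∇_(v,u) is injective and sends u to v), and compatibility
-- makes α(v',v), α(v,u), α(u,w) coplanar. As α(v,v') and α(v,u) are independent, α(u,w) lies in
-- their span. So if the F-edges at v have α-values in W, so do those at u, and connectedness of F
-- carries this from p to every edge.
module Submission where

open import Defs
open import Level using (Level; _⊔_)
open import Data.Nat using (ℕ)
open import Data.Fin using (Fin)
open import Data.Bool using (true)
open import Relation.Binary.PropositionalEquality using (_≡_)
open import Relation.Nullary using (¬_)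
open import Function using (_∘_; id)

open import Data.Bool.Properties using () renaming (_≟_ to _≟ᵇ_)
open import Data.Product using (∃-syntax; _×_; _,_; proj₁; proj₂)
open import Data.Sum using (_⊎_; inj₁; inj₂)
open import Data.Empty using (⊥-elim)
open import Relation.Binary.PropositionalEquality using (refl; sym; trans; cong; subst; module ≡-Reasoning)
open import Axiom.UniquenessOfIdentityProofs using (module Decidable⇒UIP)
import Relation.Binary.Reasoning.Setoid as SetoidReasoning
import Algebra.Properties.Ring as RingProperties

module PlaneSpan {c ℓ : Level} (K : Field c ℓ) (n : ℕ) where
  open Field K renaming (refl to ≈-refl; sym to ≈-sym; trans to ≈-trans)
  open LinAlg K n
  open SetoidReasoning setoid
  open RingProperties ring
    using (-‿distribˡ-*; -‿distribʳ-*; -‿+-comm; -‿injective; -0#≈0#; +-inverseʳ-unique)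
  open import Algebra.Solver.Ring.NaturalCoefficients.Default commutativeSemiring

  -‿distrib-lin : ∀ a b x y → - (a * x + b * y) ≈ - a * x + - b * y
  -‿distrib-lin a b x y = begin
    - (a * x + b * y)       ≈˘⟨ -‿+-comm (a * x) (b * y) ⟩
    - (a * x) + - (b * y)   ≈⟨ +-cong (-‿distribˡ-* a x) (-‿distribˡ-* b y) ⟩
    - a * x + - b * y       ∎

  -≈0⇒≈0 : ∀ {a} → - a ≈ 0# → a ≈ 0#
  -≈0⇒≈0 -a≈0 = -‿injective (≈-trans -a≈0 (≈-sym -0#≈0#))

  inSpan2-left : ∀ u v → InSpan2 u v u
  inSpan2-left u v = 1# , 0# , λ i →
    solve 2 (λ x y → x := con 1 :* x :+ con 0 :* y) ≈-refl (u i) (v i)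

  inSpan2-right : ∀ u v → InSpan2 u v v
  inSpan2-right u v = 0# , 1# , λ i →
    solve 2 (λ x y → y := con 0 :* x :+ con 1 :* y) ≈-refl (u i) (v i)

  inSpan2-negated : ∀ {u v w w'} → w' ≈ᵛ (-ᵛ w) → InSpan2 u v w → InSpan2 u v w'
  inSpan2-negated {u} {v} {w} {w'} w'≈-w (a , b , w≈) = - a , - b , λ i → begin
    w' i                    ≈⟨ w'≈-w i ⟩
    - w i                   ≈⟨ -‿cong (w≈ i) ⟩
    - (a * u i + b * v i)   ≈⟨ -‿distrib-lin a b (u i) (v i) ⟩
    - a * u i + - b * v i   ∎

  inSpan2-trans : ∀ {u v s t w} → InSpan2 u v s → InSpan2 u v t → InSpan2 s t w → InSpan2 u v w
  inSpan2-trans {u} {v} {s} {t} {w} (a₁ , b₁ , s≈) (a₂ , b₂ , t≈) (a , b , w≈) =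
    a * a₁ + b * a₂ , a * b₁ + b * b₂ , λ i → begin
      w i                                                ≈⟨ w≈ i ⟩
      a * s i + b * t i                                  ≈⟨ +-cong (*-congˡ (s≈ i)) (*-congˡ (t≈ i)) ⟩
      a * (a₁ * u i + b₁ * v i) + b * (a₂ * u i + b₂ * v i)
        ≈⟨ solve 8 (λ a b a₁ b₁ a₂ b₂ x y →
             a :* (a₁ :* x :+ b₁ :* y) :+ b :* (a₂ :* x :+ b₂ :* y)
               := (a :* a₁ :+ b :* a₂) :* x :+ (a :* b₁ :+ b :* b₂) :* y)
             ≈-refl a b a₁ b₁ a₂ b₂ (u i) (v i) ⟩
      (a * a₁ + b * a₂) * u i + (a * b₁ + b * b₂) * v i  ∎

  independent2-negatedˡ : ∀ {u u' v} → u' ≈ᵛ (-ᵛ u) → Independent2 u v → Independent2 u' v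
  independent2-negatedˡ {u} {u'} {v} u'≈-u ind a b a·u'+b·v≈0 =
    let -a≈0 , b≈0 = ind (- a) b -a·u+b·v≈0 in -≈0⇒≈0 -a≈0 , b≈0
    where
    -a·u+b·v≈0 : lin2 (- a) u b v ≈ᵛ 0ᵛ
    -a·u+b·v≈0 i = begin
      - a * u i + b * v i   ≈˘⟨ +-congʳ (-‿distribˡ-* a (u i)) ⟩
      - (a * u i) + b * v i ≈⟨ +-congʳ (-‿distribʳ-* a (u i)) ⟩
      a * - u i + b * v i   ≈˘⟨ +-congʳ (*-congˡ (u'≈-u i)) ⟩
      a * u' i + b * v i    ≈⟨ a·u'+b·v≈0 i ⟩
      0#                    ∎

  independent2∧coplanar⇒inSpan2 : ∀ {u v w} → Independent2 u v → Coplanar u v w → InSpan2 u v w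
  independent2∧coplanar⇒inSpan2 {u} {v} {w} ind (a , b , d , dependence , nontrivial) =
    let e , d·e≈1 = inverse d d≉0 in
    - (e * a) , - (e * b) , λ i → begin
      w i                               ≈˘⟨ *-identityˡ (w i) ⟩
      1# * w i                          ≈˘⟨ *-congʳ d·e≈1 ⟩
      d * e * w i                       ≈⟨ solve 3 (λ d e x → d :* e :* x := e :* (d :* x)) ≈-refl d e (w i) ⟩
      e * (d * w i)                     ≈⟨ *-congˡ (+-inverseʳ-unique _ _ (dependence i)) ⟩
      e * - (a * u i + b * v i)         ≈˘⟨ -‿distribʳ-* e _ ⟩
      - (e * (a * u i + b * v i))       ≈⟨ -‿cong (solve 5 (λ a b e x y →
                                              e :* (a :* x :+ b :* y) := e :* a :* x :+ e :* b :* y)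
                                            ≈-refl a b e (u i) (v i)) ⟩
      - (e * a * u i + e * b * v i)     ≈⟨ -‿distrib-lin (e * a) (e * b) (u i) (v i) ⟩
      - (e * a) * u i + - (e * b) * v i ∎
    where
    d≉0 : ¬ (d ≈ 0#)
    d≉0 d≈0 = let a≈0 , b≈0 = ind a b λ i → begin
                    a * u i + b * v i              ≈˘⟨ +-identityʳ _ ⟩
                    a * u i + b * v i + 0#         ≈˘⟨ +-congˡ (zeroˡ (w i)) ⟩
                    a * u i + b * v i + 0# * w i   ≈˘⟨ +-congˡ (*-congʳ d≈0) ⟩
                    a * u i + b * v i + d * w i    ≈⟨ dependence i ⟩
                    0#                             ∎
              in nontrivial (a≈0 , b≈0 , d≈0)

≡true-irrelevant : ∀ {b} (p q : b ≡ true) → p ≡ q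
≡true-irrelevant = Decidable⇒UIP.≡-irrelevant _≟ᵇ_

module ConnectionProperties {m : ℕ} {Γ : Graph m} (∇c : Connection Γ) where
  open Connection ∇c

  ∇-cong : ∀ x y (e : Edge Γ x y) {z z'} (f : Edge Γ x z) (f' : Edge Γ x z') →
    z ≡ z' → ∇ x y e z f ≡ ∇ x y e z' f'
  ∇-cong x y e f f' refl = cong (∇ x y e _) (≡true-irrelevant f f')

  ∇-injective : ∀ x y (e : Edge Γ x y) {z z'} (f : Edge Γ x z) (f' : Edge Γ x z') →
    ∇ x y e z f ≡ ∇ x y e z' f' → z ≡ z'
  ∇-injective x y e {z} {z'} f f' eq = begin
    z                               ≡˘⟨ ∇-inv x y e e' z f ⟩
    ∇ y x e' (∇ x y e z f) _        ≡⟨ ∇-cong y x e' (∇-edge x y e z f) (∇-edge x y e z' f') eq ⟩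
    ∇ y x e' (∇ x y e z' f') _      ≡⟨ ∇-inv x y e e' z' f' ⟩
    z'                              ∎
    where
    open ≡-Reasoning
    e' = Graph.symm Γ x y e

two-distinct-cover : ∀ {A : Set} {a b v w y : A} → ¬ (v ≡ w) →
  v ≡ a ⊎ v ≡ b → w ≡ a ⊎ w ≡ b → y ≡ a ⊎ y ≡ b → y ≡ v ⊎ y ≡ w
two-distinct-cover v≢w (inj₁ refl) _           (inj₁ refl) = inj₁ refl
two-distinct-cover v≢w (inj₂ refl) _           (inj₂ refl) = inj₁ refl
two-distinct-cover v≢w (inj₁ refl) (inj₂ refl) (inj₂ refl) = inj₂ refl
two-distinct-cover v≢w (inj₂ refl) (inj₁ refl) (inj₁ refl) = inj₂ refl
two-distinct-cover v≢w (inj₁ refl) (inj₁ refl) (inj₂ refl) = ⊥-elim (v≢w refl)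
two-distinct-cover v≢w (inj₂ refl) (inj₂ refl) (inj₁ refl) = ⊥-elim (v≢w refl)

module TwoValence {m : ℕ} {Γ : Graph m} {F : Subgraph Γ} (twoValent : TwoValent Γ F) where
  open Subgraph F

  another-neighbour : ∀ {v u} → E₀ v u ≡ true → ∃[ v' ] E₀ v v' ≡ true × ¬ (v' ≡ u)
  another-neighbour {v} f with twoValent v (E₀-V₀ _ _ f)
  ... | y₁ , y₂ , y₁≢y₂ , f₁ , f₂ , cover with cover _ f
  ...   | inj₁ refl = y₂ , f₂ , λ y₂≡y₁ → y₁≢y₂ (sym y₂≡y₁)
  ...   | inj₂ refl = y₁ , f₁ , y₁≢y₂

  neighbour-cases : ∀ {x v w y} → ¬ (v ≡ w) →
    E₀ x v ≡ true → E₀ x w ≡ true → E₀ x y ≡ true → y ≡ v ⊎ y ≡ w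
  neighbour-cases {x} v≢w fv fw fy with twoValent x (E₀-V₀ _ _ fv)
  ... | _ , _ , _ , _ , _ , cover = two-distinct-cover v≢w (cover _ fv) (cover _ fw) (cover _ fy)

module _ {c ℓ : Level} (K : Field c ℓ) (n : ℕ) {m : ℕ} (Γ : Graph m) where
  open LinAlg K n

  TwoIndependent : Connection Γ → AxialFunction Γ → Set (c ⊔ ℓ)
  TwoIndependent ∇c α = ∀ p y₁ y₂ (e₁ : Edge Γ p y₁) (e₂ : Edge Γ p y₂) →
    ¬ (y₁ ≡ y₂) → Independent2 (α p y₁ e₁) (α p y₂ e₂)

module AxialSpan {c ℓ : Level} (K : Field c ℓ) (n : ℕ) {m : ℕ} (Γ : Graph m)
    (∇c : Connection Γ) (α : LinAlg.AxialFunction K n Γ)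
    (compatible : LinAlg.Compatible K n Γ ∇c α)
    (twoIndependent : TwoIndependent K n Γ ∇c α)
    (F : Subgraph Γ) (geodesic : TotallyGeodesic Γ ∇c F) (twoValent : TwoValent Γ F) where
  open LinAlg K n
  open PlaneSpan K n
  open Connection ∇c
  open ConnectionProperties ∇c
  open TwoValence {Γ = Γ} {F} twoValent
  open Subgraph F

  αF : ∀ x y → E₀ x y ≡ true → Vect
  αF x y f = α x y (E₀⊆E x y f)

  StarInSpan2 : Vect → Vect → Fin m → Set (c ⊔ ℓ)
  StarInSpan2 U V x = ∀ y (f : E₀ x y ≡ true) → InSpan2 U V (αF x y f)

  reversed-inSpan2 : ∀ {U V x y} (f : E₀ x y ≡ true) (f' : E₀ y x ≡ true) →
    InSpan2 U V (αF x y f) → InSpan2 U V (αF y x f')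
  reversed-inSpan2 {x = x} {y} _ _ = inSpan2-negated (proj₁ compatible x y _ _)

  module Turn {v u v'} (f : E₀ v u ≡ true) (f' : E₀ v v' ≡ true) where
    e : Edge Γ v u
    e = E₀⊆E v u f

    e' : Edge Γ v v'
    e' = E₀⊆E v v' f'

    w : Fin m
    w = ∇ v u e v' e'

    turn-edge : E₀ u w ≡ true
    turn-edge = geodesic v u f v' f'

    turn-inSpan2 : ¬ (v' ≡ u) → (g : E₀ u w ≡ true) →
      InSpan2 (αF v' v (E₀-symm v v' f')) (αF v u f) (αF u w g)
    turn-inSpan2 v'≢u g = independent2∧coplanar⇒inSpan2
      (independent2-negatedˡ (proj₁ compatible v v' e' (E₀⊆E v' v (E₀-symm v v' f')))
        (twoIndependent v v' u e' e v'≢u))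
      (proj₂ compatible v' v u w _ _ _ _ refl)

    turn-not-back : ¬ (v' ≡ u) → ¬ (v ≡ w)
    turn-not-back v'≢u v≡w = v'≢u (∇-injective v u _ _ _ (trans (sym v≡w) (sym (∇-base v u _))))

    starInSpan2-turn : ∀ {U V} → ¬ (v' ≡ u) → StarInSpan2 U V v → StarInSpan2 U V u
    starInSpan2-turn v'≢u star-v y fy
      with neighbour-cases (turn-not-back v'≢u) (E₀-symm v u f) turn-edge fy
    ... | inj₁ refl = reversed-inSpan2 f fy (star-v u f)
    ... | inj₂ refl = inSpan2-trans (reversed-inSpan2 f' _ (star-v v' f')) (star-v u f)
                        (turn-inSpan2 v'≢u fy)

  starInSpan2-step : ∀ {U V v u} → E₀ v u ≡ true → StarInSpan2 U V v → StarInSpan2 U V u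
  starInSpan2-step f with another-neighbour f
  ... | v' , f' , v'≢u = Turn.starInSpan2-turn f f' v'≢u

  starInSpan2-walk : ∀ {U V x y} → Walk Γ F x y → StarInSpan2 U V x → StarInSpan2 U V y
  starInSpan2-walk stop         = id
  starInSpan2-walk (step f walk) = starInSpan2-walk walk ∘ starInSpan2-step f

  starInSpan2-base : ∀ {p y₁ y₂} (f₁ : E₀ p y₁ ≡ true) (f₂ : E₀ p y₂ ≡ true) → ¬ (y₁ ≡ y₂) →
    StarInSpan2 (αF p y₁ f₁) (αF p y₂ f₂) p
  starInSpan2-base {p} {y₁} {y₂} f₁ f₂ y₁≢y₂ y fy with neighbour-cases y₁≢y₂ f₁ f₂ fy
  ... | inj₁ refl = subst (InSpan2 _ _ ∘ αF p y) (≡true-irrelevant f₁ fy) (inSpan2-left _ _)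
  ... | inj₂ refl = subst (InSpan2 _ _ ∘ αF p y) (≡true-irrelevant f₂ fy) (inSpan2-right _ _)

mainTheorem11 : ∀ {c ℓ : Level} (K : Field c ℓ) (n m : ℕ) (Γ : Graph m)
    (∇c : Connection Γ) (α : LinAlg.AxialFunction K n Γ) →
    LinAlg.NonZero K n Γ ∇c α →
    LinAlg.Compatible K n Γ ∇c α →
    LinAlg.ThreeIndependent K n Γ ∇c α →
    (F : Subgraph Γ) → TwoFace Γ ∇c F →
    (p y₁ y₂ : Fin m) → Subgraph.V₀ F p ≡ true →
    (f₁ : Subgraph.E₀ F p y₁ ≡ true) (f₂ : Subgraph.E₀ F p y₂ ≡ true) →
    ¬ (y₁ ≡ y₂) →
    (x y : Fin m) (f : Subgraph.E₀ F x y ≡ true) →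
    LinAlg.InSpan2 K n
      (α p y₁ (Subgraph.E₀⊆E F p y₁ f₁))
      (α p y₂ (Subgraph.E₀⊆E F p y₂ f₂))
      (α x y (Subgraph.E₀⊆E F x y f))
mainTheorem11 K n m Γ ∇c α _ compatible (twoIndependent , _) F (connected , geodesic , twoValent)
  p y₁ y₂ p∈F f₁ f₂ y₁≢y₂ x y f =
  starInSpan2-walk (connected p x p∈F (Subgraph.E₀-V₀ F x y f)) (starInSpan2-base f₁ f₂ y₁≢y₂) y f
  where open AxialSpan K n Γ ∇c α compatible twoIndependent F geodesic twoValent
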